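{- Given $f:\omega\to\omega$ and $q=\langle\langle F^i_j:j<m_i;Y_i\rangle:i\in\omega\rangle\in\mathbb P$, there is $p=\langle\langle E^i_j:j<n_i;X_i\rangle:i\in\omega\rangle\le q$ in $\mathbb P$ such that either $f\restriction\bigcup_iX_i$ is constant, or $f\restriction\bigcup_iX_i$ is one-to-one, or else $f\restriction X_i$ is constant for each $i$ but $f$ takes distinct values on $X_i$ and $X_{i'}$ for $i\ne i'$.
   Context: For equivalence relations $E,F$ on a set, $E<_\infty F$ means each $F$-equivalence class is the union of infinitely many $E$-classes. $\mathbb P$ is the set of all sequences $\langle\langle E^i_j:j<n_i;X_i\rangle:i\in\omega\rangle$ where the $X_i$ are pairwise disjoint infinite subsets of $\omega$, for each $i$, $E^i_0<_\infty E^i_1<_\infty\cdots<_\infty E^i_{n_i-1}$ are equivalence relations on $X_i$ with $E^i_0$ the identity relation and $E^i_{n_i-1}$ having only one class, and $\limsup_{i\to\infty}n_i=\infty$. The order is: $\langle\langle E^i_j:j<n_i;X_i\rangle:i\in\omega\rangle\le\langle\langle F^i_j:j<m_i;Y_i\rangle:i\in\omega\rangle$ iff for all but finitely many $i$ there exist $k$ with $X_i\subseteq Y_k$ and an increasing map $\pi:n_i\to m_k$ with $E^i_j=F^k_{\pi(j)}\restriction X_i$ for all $j<n_i$. -}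

module Defs where

open import Data.Nat using (ℕ; zero; suc; _≤_; _<_; _∸_)
open import Data.Fin using (Fin; toℕ)
open import Data.Product using (Σ; ∃; ∃-syntax; _×_; _,_)
open import Data.Sum using (_⊎_)
open import Data.Empty using (⊥)
open import Relation.Nullary using (¬_)
open import Relation.Binary.PropositionalEquality using (_≡_; _≢_)
open import Function.Bundles using (_⇔_)

Subset : Set₁
Subset = ℕ → Set

Rel : Set₁
Rel = ℕ → ℕ → Set

Infinite : Subset → Set
Infinite X = ∀ k → ∃[ a ] (k ≤ a × X a)

IsEquivOn : Subset → Rel → Set
IsEquivOn X R =
  (∀ {a} → X a → R a a) ×
  (∀ {a b} → X a → X b → R a b → R b a) ×
  (∀ {a b c} → X a → X b → X c → R a b → R b c → R a c)

-- E <∞ F on X: each F-class is the union of infinitely many E-classes.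
-- (i) every E-class is contained in an F-class, and
-- (ii) every F-class contains, for every k, k pairwise E-inequivalent points.
_<∞_on_ : Rel → Rel → Subset → Set
E <∞ F on X =
  (∀ {a b} → X a → X b → E a b → F a b) ×
  (∀ {a} → X a → (k : ℕ) → Σ (Fin k → ℕ) λ g →
      (∀ m → X (g m)) × (∀ m → F a (g m)) ×
      (∀ m m' → m ≢ m' → ¬ E (g m) (g m')))

record Cond : Set₁ where
  field
    X : ℕ → Subset
    n : ℕ → ℕ
    E : (i : ℕ) → Fin (n i) → Rel
    disjoint : ∀ {i i' a} → i ≢ i' → X i a → X i' a → ⊥
    infinite : ∀ i → Infinite (X i)
    nonempty : ∀ i → 1 ≤ n i
    equiv    : ∀ i j → IsEquivOn (X i) (E i j)
    chain    : ∀ i (j j' : Fin (n i)) → toℕ j' ≡ suc (toℕ j) →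
                 E i j <∞ E i j' on X i
    bottom   : ∀ i (j : Fin (n i)) → toℕ j ≡ 0 →
                 ∀ {a b} → X i a → X i b → (E i j a b ⇔ (a ≡ b))
    top      : ∀ i (j : Fin (n i)) → toℕ j ≡ n i ∸ 1 →
                 ∀ {a b} → X i a → X i b → E i j a b
    limsup   : ∀ N k → ∃[ i ] (k ≤ i × N ≤ n i)

open Cond public

StrictlyIncreasing : ∀ {n m} → (Fin n → Fin m) → Set
StrictlyIncreasing π = ∀ j j' → toℕ j < toℕ j' → toℕ (π j) < toℕ (π j')

_≤ℙ_ : Cond → Cond → Set
p ≤ℙ q = ∃[ M ] (∀ i → M ≤ i → ∃[ k ]
  ((∀ {a} → X p i a → X q k a) ×
   Σ (Fin (n p i) → Fin (n q k)) λ π → StrictlyIncreasing π ×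
     (∀ j {a b} → X p i a → X p i b → (E p i j a b ⇔ E q k (π j) a b))))

Union : Cond → Subset
Union p a = ∃[ i ] X p i a

ConstantOn : (ℕ → ℕ) → Subset → Set
ConstantOn f U = ∀ {a b} → U a → U b → f a ≡ f b

InjectiveOn : (ℕ → ℕ) → Subset → Set
InjectiveOn f U = ∀ {a b} → U a → U b → f a ≡ f b → a ≡ b

PiecewiseConstantDistinct : (ℕ → ℕ) → Cond → Set
PiecewiseConstantDistinct f p =
  (∀ i → ConstantOn f (X p i)) ×
  (∀ {i i' a b} → i ≢ i' → X p i a → X p i' b → f a ≢ f b)

-- Law of excluded middle (the paper works in classical ZFC)
LEM : Set₁
LEM = (P : Set) → P ⊎ ¬ P

{-# OPTIONS --safe #-}
-- The i-th of a sequence of pieces of q with at least 2i+2 levels F_0 <∞ ⋯ <∞ F_{2i+1} unfolds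
-- into an ω-branching tree of classes: a node of height j is an F_j-class, and its children are
-- infinitely many distinct F_{j-1}-classes inside it, down to points. Keeping only the heights
-- j_0 = 0 < ⋯ < j_c of a subtree gives a new piece with chain F_{j_0} <∞ ⋯ <∞ F_{j_c}. A Ramsey
-- argument by induction on the height finds in a tree of height a + b - 1 a subtree of height a on
-- which f is constant or one of height b on which f is injective; to graft subtrees of children
-- together, pass to infinitely many children whose subtrees use the same heights (pigeonhole), and
-- thin injective ones so that their f-images become disjoint. With a = b = i + 1: if the injective
-- case occurs infinitely often, the disjointly thinned injective subtrees form p; otherwise almost
-- all pieces carry constant subtrees, whose values are equal or pairwise distinct along a
-- subsequence.

module Submission where

open import Defs
open import Data.Nat using (ℕ; zero; suc; _+_; _≤_; _<_; _≤?_; _≟_; z≤n; s≤s; _⊔_)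
open import Data.Nat.Properties
open import Data.Fin as Fin using (Fin; toℕ; fromℕ<)
open import Data.Fin.Properties using (toℕ-injective; toℕ-fromℕ<; toℕ<n; pigeonhole)
open import Data.Product using (Σ; ∃; ∃-syntax; _×_; _,_; proj₁; proj₂)
open import Data.Sum using (_⊎_; inj₁; inj₂; [_,_]′)
open import Data.Empty using (⊥-elim)
open import Data.Vec using (Vec; []; _∷_)
open import Function using (_∘_; id; case_of_)
open import Function.Definitions using (Injective; StrictlySurjective)
open import Relation.Nullary using (¬_; yes; no; contradiction)
open import Relation.Binary.Definitions using (tri<; tri≈; tri>)
open import Relation.Binary.PropositionalEquality
open import Function.Bundles using (mk⇔)

private variable
  P : Subset
  g : ℕ → ℕ
  s t : ℕ

Ascending : (ℕ → ℕ) → Set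
Ascending σ = ∀ s → σ s < σ (suc s)

ascending-< : {σ : ℕ → ℕ} → Ascending σ → s < t → σ s < σ t
ascending-< {s} {suc t} σ↑ (s≤s s≤t) with m≤n⇒m<n∨m≡n s≤t
... | inj₁ s<t  = <-trans (ascending-< σ↑ s<t) (σ↑ t)
... | inj₂ refl = σ↑ s

ascending-injective : {σ : ℕ → ℕ} → Ascending σ → Injective _≡_ _≡_ σ
ascending-injective σ↑ {s} {t} eq with <-cmp s t
... | tri< s<t _ _ = contradiction eq (<⇒≢ (ascending-< σ↑ s<t))
... | tri≈ _ s≡t _ = s≡t
... | tri> _ _ t<s = contradiction (sym eq) (<⇒≢ (ascending-< σ↑ t<s))

ascending-inflationary : {σ : ℕ → ℕ} → Ascending σ → ∀ s → s ≤ σ s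
ascending-inflationary σ↑ zero    = z≤n
ascending-inflationary σ↑ (suc s) = ≤-<-trans (ascending-inflationary σ↑ s) (σ↑ s)

ascending-∘ : {σ τ : ℕ → ℕ} → Ascending σ → Ascending τ → Ascending (σ ∘ τ)
ascending-∘ σ↑ τ↑ s = ascending-< σ↑ (τ↑ s)

module _ {R : ℕ → ℕ → Set} (next : ∀ r → ∃[ r′ ] R r r′) (r₀ : ℕ) where
  iterate : ℕ → ℕ
  iterate zero    = r₀
  iterate (suc s) = proj₁ (next (iterate s))

  iterate-step : ∀ s → R (iterate s) (iterate (suc s))
  iterate-step s = proj₂ (next (iterate s))

module _ (inf : Infinite P) where
  enumerate : ℕ → ℕ
  enumerate = iterate (λ r → inf (suc r)) (proj₁ (inf 0))

  enumerate-∈ : ∀ s → P (enumerate s)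
  enumerate-∈ zero    = proj₂ (proj₂ (inf 0))
  enumerate-∈ (suc s) = proj₂ (iterate-step (λ r → inf (suc r)) _ s)

  enumerate-ascending : Ascending enumerate
  enumerate-ascending s = proj₁ (iterate-step (λ r → inf (suc r)) _ s)

FiniteFibres : (ℕ → ℕ) → Set
FiniteFibres g = ∀ x → ¬ Infinite (λ r → g r ≡ x)

injective⇒finiteFibres : Injective _≡_ _≡_ g → FiniteFibres g
injective⇒finiteFibres inj x inf =
  let r₁ , _ , e₁ = inf 0
      r₂ , r₁<r₂ , e₂ = inf (suc r₁)
  in <⇒≢ r₁<r₂ (inj (trans e₁ (sym e₂)))

Enumerable : Set → Set
Enumerable A = Σ (ℕ → A) (StrictlySurjective _≡_)

ℕ-enumerable : Enumerable ℕ
ℕ-enumerable = id , λ n → n , refl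

next-on-diagonal : ℕ × ℕ → ℕ × ℕ
next-on-diagonal (zero  , b) = suc b , zero
next-on-diagonal (suc a , b) = a , suc b

unpair : ℕ → ℕ × ℕ
unpair zero    = 0 , 0
unpair (suc n) = next-on-diagonal (unpair n)

unpair-reaches-diagonal : ∀ d a b → a + b ≡ d → ∃[ n ] unpair n ≡ (a , b)
unpair-reaches-diagonal d a (suc b) a+1+b≡d =
  let n , eq = unpair-reaches-diagonal d (suc a) b (trans (sym (+-suc a b)) a+1+b≡d)
  in suc n , cong next-on-diagonal eq
unpair-reaches-diagonal d       zero    zero _ = zero , refl
unpair-reaches-diagonal (suc d) (suc a) zero a+0≡d =
  let n , eq = unpair-reaches-diagonal d zero a (trans (sym (+-identityʳ a)) (suc-injective a+0≡d))
  in suc n , cong next-on-diagonal eq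

unpair-surjective : StrictlySurjective _≡_ unpair
unpair-surjective (a , b) = unpair-reaches-diagonal (a + b) a b refl

enumerable-image : {A B : Set} (f : A → B) → StrictlySurjective _≡_ f → Enumerable A → Enumerable B
enumerable-image f f-onto (e , e-onto) = f ∘ e , λ b →
  let a , fa≡b = f-onto b
      n , en≡a = e-onto a
  in n , trans (cong f en≡a) fa≡b

enumerable-× : {A B : Set} → Enumerable A → Enumerable B → Enumerable (A × B)
enumerable-× (e₁ , e₁-onto) (e₂ , e₂-onto) = enumerable-image
  (λ (m , n) → e₁ m , e₂ n)
  (λ (a , b) → let m , e₁m≡a = e₁-onto a ; n , e₂n≡b = e₂-onto b in (m , n) , cong₂ _,_ e₁m≡a e₂n≡b)
  (unpair , unpair-surjective)

enumerable-Vec : {A : Set} → Enumerable A → ∀ k → Enumerable (Vec A k)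
enumerable-Vec enum zero    = (λ _ → []) , λ { [] → 0 , refl }
enumerable-Vec enum (suc k) = enumerable-image (λ (x , v) → x ∷ v) (λ { (x ∷ v) → (x , v) , refl })
                                (enumerable-× enum (enumerable-Vec enum k))

enumerable-Σℕ : {B : ℕ → Set} → (∀ r → Enumerable (B r)) → Enumerable (Σ ℕ B)
enumerable-Σℕ enum = enumerable-image
  (λ (r , m) → r , proj₁ (enum r) m)
  (λ (r , b) → let m , e≡b = proj₂ (enum r) b in (r , m) , cong (r ,_) e≡b)
  (unpair , unpair-surjective)

module Classical (lem : LEM) where

  byContradiction : {A : Set} → ¬ ¬ A → A
  byContradiction {A} ¬¬a with lem A
  ... | inj₁ a  = a
  ... | inj₂ ¬a = ⊥-elim (¬¬a ¬a)

  finite⇒eventually-¬ : ¬ Infinite P → ∃[ K ] ∀ r → K ≤ r → ¬ P r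
  finite⇒eventually-¬ fin =
    byContradiction λ ¬bound → fin λ k →
      byContradiction λ ¬above → ¬bound (k , λ r k≤r pr → ¬above (r , k≤r , pr))

  finiteFibres⇒eventually-> : FiniteFibres g → ∀ B → ∃[ K ] ∀ r → K ≤ r → B < g r
  finiteFibres⇒eventually-> fin zero =
    let K , ≢0 = finite⇒eventually-¬ (fin 0) in K , λ r K≤r → n≢0⇒n>0 (≢0 r K≤r)
  finiteFibres⇒eventually-> fin (suc B) =
    let K  , >B  = finiteFibres⇒eventually-> fin B
        K′ , ≢1+B = finite⇒eventually-¬ (fin (suc B))
    in K ⊔ K′ , λ r K⊔K′≤r →
         ≤∧≢⇒< (>B r (m⊔n≤o⇒m≤o K K′ K⊔K′≤r)) (≢1+B r (m⊔n≤o⇒n≤o K K′ K⊔K′≤r) ∘ sym)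

  injective⇒unbounded : Injective _≡_ _≡_ g → ∀ B → ∃[ r ] B < g r
  injective⇒unbounded inj B =
    let K , >B = finiteFibres⇒eventually-> (injective⇒finiteFibres inj) B in K , >B K ≤-refl

  finiteFibres⇒ascending-subsequence : FiniteFibres g → Σ (ℕ → ℕ) λ σ → Ascending σ × Ascending (g ∘ σ)
  finiteFibres⇒ascending-subsequence {g} fin =
    iterate next 0 , (λ s → proj₁ (iterate-step next 0 s)) , (λ s → proj₂ (iterate-step next 0 s))
    where
    next : ∀ r → ∃[ r′ ] r < r′ × g r < g r′
    next r = let K , >gr = finiteFibres⇒eventually-> fin (g r)
             in suc r ⊔ K , m≤m⊔n (suc r) K , >gr _ (m≤n⊔m (suc r) K)

  infinite-fibre-or-ascending : (g : ℕ → ℕ) →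
    (∃[ x ] Infinite (λ r → g r ≡ x)) ⊎ (Σ (ℕ → ℕ) λ σ → Ascending σ × Ascending (g ∘ σ))
  infinite-fibre-or-ascending g with lem (∃[ x ] Infinite (λ r → g r ≡ x))
  ... | inj₁ fibre   = inj₁ fibre
  ... | inj₂ ¬fibre = inj₂ (finiteFibres⇒ascending-subsequence λ x inf → ¬fibre (x , inf))

  bounded⇒infinite-fibre : ∀ B → (∀ r → g r ≤ B) → ∃[ x ] Infinite (λ r → g r ≡ x)
  bounded⇒infinite-fibre B g≤B = byContradiction λ ¬fibre →
    let K , >B = finiteFibres⇒eventually-> (λ x inf → ¬fibre (x , inf)) B
    in <⇒≱ (>B K ≤-refl) (g≤B K)

  agreeing-subsequence : ∀ c B (L : ℕ → ℕ → ℕ) → (∀ r j → j < c → L r j ≤ B) →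
    Σ (ℕ → ℕ) λ τ → Ascending τ × ∀ s j → j < c → L (τ s) j ≡ L (τ 0) j
  agreeing-subsequence zero    B L L≤B = id , (λ _ → ≤-refl) , λ _ _ ()
  agreeing-subsequence (suc c) B L L≤B =
    let τ , τ↑ , τ-agree = agreeing-subsequence c B L λ r j j<c → L≤B r j (m<n⇒m<1+n j<c)
        _ , fibre = bounded⇒infinite-fibre B λ s → L≤B (τ s) c ≤-refl
        σ = enumerate fibre
    in τ ∘ σ , ascending-∘ τ↑ (enumerate-ascending fibre) , λ s j j<1+c →
       case m<1+n⇒m<n∨m≡n j<1+c of λ where
         (inj₁ j<c)  → trans (τ-agree (σ s) j j<c) (sym (τ-agree (σ 0) j j<c))
         (inj₂ refl) → trans (enumerate-∈ fibre s) (sym (enumerate-∈ fibre 0))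

  separating-choice : {A : Set} → Enumerable A → (h : A → ℕ → ℕ) → (∀ a → Injective _≡_ _≡_ (h a)) →
    Σ (A → ℕ) λ t → Injective _≡_ _≡_ (λ a → h a (t a))
  separating-choice {A} (e , e-onto) h h-injective = index ∘ code , chosen-injective
    where
    larger : ∀ n B → ∃[ i ] B < h (e n) i
    larger n = injective⇒unbounded (h-injective (e n))
    index : ℕ → ℕ
    index zero    = 0
    index (suc n) = proj₁ (larger (suc n) (h (e n) (index n)))
    value : ℕ → ℕ
    value n = h (e n) (index n)
    value-ascending : Ascending value
    value-ascending n = proj₂ (larger (suc n) (value n))
    code : A → ℕ
    code a = proj₁ (e-onto a)
    chosen≡value : ∀ a → h a (index (code a)) ≡ value (code a)
    chosen≡value a = cong (λ x → h x (index (code a))) (sym (proj₂ (e-onto a)))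
    chosen-injective : Injective _≡_ _≡_ (λ a → h a (index (code a)))
    chosen-injective {a} {a′} eq = begin
      a             ≡⟨ sym (proj₂ (e-onto a)) ⟩
      e (code a)    ≡⟨ cong e (ascending-injective value-ascending
                         (trans (sym (chosen≡value a)) (trans eq (chosen≡value a′)))) ⟩
      e (code a′)   ≡⟨ proj₂ (e-onto a′) ⟩
      a′            ∎
      where open ≡-Reasoning

AscendingBelow : ℕ → (ℕ → ℕ) → Set
AscendingBelow c lv = ∀ j → j < c → lv j < lv (suc j)

ascendingBelow-< : ∀ {c lv} → AscendingBelow c lv → ∀ {j j′} → j < j′ → j′ ≤ c → lv j < lv j′
ascendingBelow-< lv↑ {j} {suc j′} (s≤s j≤j′) 1+j′≤c with m≤n⇒m<n∨m≡n j≤j′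
... | inj₁ j<j′ = <-trans (ascendingBelow-< lv↑ j<j′ (<⇒≤ 1+j′≤c)) (lv↑ j′ 1+j′≤c)
... | inj₂ refl = lv↑ j 1+j′≤c

ascendingBelow-≤ : ∀ {c lv} → AscendingBelow c lv → ∀ {j j′} → j ≤ j′ → j′ ≤ c → lv j ≤ lv j′
ascendingBelow-≤ lv↑ j≤j′ j′≤c with m≤n⇒m<n∨m≡n j≤j′
... | inj₁ j<j′ = <⇒≤ (ascendingBelow-< lv↑ j<j′ j′≤c)
... | inj₂ refl = ≤-refl

extend : (ℕ → ℕ) → ℕ → ℕ → ℕ → ℕ
extend lv c x j with j ≤? c
... | yes _ = lv j
... | no  _ = x

extend-≤ : ∀ lv {c} x {j} → j ≤ c → extend lv c x j ≡ lv j
extend-≤ lv {c} x {j} j≤c with j ≤? c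
... | yes _   = refl
... | no  j≰c = contradiction j≤c j≰c

extend-suc : ∀ lv c x → extend lv c x (suc c) ≡ x
extend-suc lv c x with suc c ≤? c
... | yes 1+c≤c = contradiction 1+c≤c (<-irrefl refl)
... | no  _     = refl

data Tree : ℕ → Set where
  leaf : ℕ → Tree zero
  node : ∀ {h} → (ℕ → Tree h) → Tree (suc h)

private variable
  h c : ℕ

Leaf : Tree h → Subset
Leaf (leaf x) a = x ≡ a
Leaf (node S) a = ∃[ r ] Leaf (S r) a

leftmost : Tree h → ℕ
leftmost (leaf x) = x
leftmost (node S) = leftmost (S 0)

leftmost-leaf : (T : Tree h) → Leaf T (leftmost T)
leftmost-leaf (leaf x) = refl
leftmost-leaf (node S) = 0 , leftmost-leaf (S 0)

height0-leaf : (T : Tree 0) → ∀ {a} → Leaf T a → leftmost T ≡ a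
height0-leaf (leaf x) x≡a = x≡a

leafAt : Tree (suc c) → Vec ℕ c → ℕ → ℕ
leafAt {zero}  (node S) []      s = leftmost (S s)
leafAt {suc c} (node S) (r ∷ v) s = leafAt (S r) v s

leafAt-leaf : (T : Tree (suc c)) (v : Vec ℕ c) (s : ℕ) → Leaf T (leafAt T v s)
leafAt-leaf {zero}  (node S) []      s = s , leftmost-leaf (S s)
leafAt-leaf {suc c} (node S) (r ∷ v) s = r , leafAt-leaf (S r) v s

thin : Tree (suc c) → (Vec ℕ c → ℕ → ℕ) → Tree (suc c)
thin {zero}  (node S) g = node (S ∘ g [])
thin {suc c} (node S) g = node λ r → thin (S r) (g ∘ (r ∷_))

thin-leaf : (T : Tree (suc c)) (g : Vec ℕ c → ℕ → ℕ) → ∀ {a} → Leaf (thin T g) a →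
  ∃[ v ] ∃[ s ] leafAt T v (g v s) ≡ a
thin-leaf {zero} (node S) g (s , a∈) = [] , s , height0-leaf (S (g [] s)) a∈
thin-leaf {suc c} (node S) g (r , a∈) =
  let v , s , eq = thin-leaf (S r) (g ∘ (r ∷_)) a∈ in r ∷ v , s , eq

thin-⊆ : (T : Tree (suc c)) (g : Vec ℕ c → ℕ → ℕ) → ∀ {a} → Leaf (thin T g) a → Leaf T a
thin-⊆ T g a∈ with thin-leaf T g a∈
... | v , s , refl = leafAt-leaf T v (g v s)

module Levelled (Y : Subset) (R : ℕ → Rel) where

  -- A valid tree of height c with levels lv 0 < ⋯ < lv c carries the chain
  -- R (lv 0) <∞ ⋯ <∞ R (lv c) on its leaves.
  Valid : (ℕ → ℕ) → Tree h → Set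
  Valid lv (leaf x)     = Y x
  Valid lv (node {h} S) =
    (∀ r → Valid lv (S r)) ×
    (∀ {r r′ a b} → r ≢ r′ → Leaf (S r) a → Leaf (S r′) b → ¬ R (lv h) a b) ×
    (∀ {a b} → Leaf (node S) a → Leaf (node S) b → R (lv (suc h)) a b)

  valid-∈ : ∀ {lv} (T : Tree h) → Valid lv T → ∀ {a} → Leaf T a → Y a
  valid-∈ (leaf x) x∈Y         refl     = x∈Y
  valid-∈ (node S) (valid , _) (r , a∈) = valid-∈ (S r) (valid r) a∈

  valid-top : ∀ {lv} (T : Tree (suc h)) → Valid lv T → ∀ {a b} → Leaf T a → Leaf T b → R (lv (suc h)) a b
  valid-top (node S) (_ , _ , related) = related

  valid-cong : ∀ {lv lv′} (T : Tree h) → (∀ j → j < suc h → lv j ≡ lv′ j) → Valid lv T → Valid lv′ T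
  valid-cong (leaf x) _ x∈Y = x∈Y
  valid-cong {suc h} (node S) lv≡lv′ (valid , separated , related) =
    (λ r → valid-cong (S r) (λ j j<1+h → lv≡lv′ j (m<n⇒m<1+n j<1+h)) (valid r)) ,
    (λ r≢r′ a∈ b∈ → subst (λ l → ¬ R l _ _) (lv≡lv′ h (m<n⇒m<1+n ≤-refl)) (separated r≢r′ a∈ b∈)) ,
    (λ a∈ b∈ → subst (λ l → R l _ _) (lv≡lv′ (suc h) ≤-refl) (related a∈ b∈))

  valid-spread : ∀ {lv} (T : Tree h) → Valid lv T → ∀ {a} → Leaf T a → ∀ j → j < h → ∀ K →
    Σ (Fin K → ℕ) λ x → (∀ m → Leaf T (x m)) × (∀ m → R (lv (suc j)) a (x m)) ×
      (∀ m m′ → m ≢ m′ → ¬ R (lv j) (x m) (x m′))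
  valid-spread (node {h} S) (valid , separated , related) (r , a∈) j (s≤s j≤h) K with m≤n⇒m<n∨m≡n j≤h
  ... | inj₂ refl =
    (λ m → leftmost (S (toℕ m))) , (λ m → toℕ m , leftmost-leaf _) ,
    (λ m → related (r , a∈) (toℕ m , leftmost-leaf _)) ,
    (λ m m′ m≢m′ → separated (m≢m′ ∘ toℕ-injective) (leftmost-leaf _) (leftmost-leaf _))
  ... | inj₁ j<h =
    let x , x∈ , related′ , separated′ = valid-spread (S r) (valid r) a∈ j j<h K
    in x , (λ m → r , x∈ m) , related′ , separated′

  thin-valid : ∀ {lv} (T : Tree (suc c)) (g : Vec ℕ c → ℕ → ℕ) → (∀ v → Injective _≡_ _≡_ (g v)) →
    Valid lv T → Valid lv (thin T g)
  thin-valid {zero} (node S) g g-injective (valid , separated , related) =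
    (valid ∘ g []) ,
    (λ r≢r′ → separated (r≢r′ ∘ g-injective [])) ,
    (λ (r , a∈) (r′ , b∈) → related (g [] r , a∈) (g [] r′ , b∈))
  thin-valid {suc c} (node S) g g-injective (valid , separated , related) =
    (λ r → thin-valid (S r) (g ∘ (r ∷_)) (g-injective ∘ (r ∷_)) (valid r)) ,
    (λ {r} {r′} r≢r′ a∈ b∈ → separated r≢r′ (thin-⊆ (S r) _ a∈) (thin-⊆ (S r′) _ b∈)) ,
    (λ (r , a∈) (r′ , b∈) → related (r , thin-⊆ (S r) _ a∈) (r′ , thin-⊆ (S r′) _ b∈))

  module _ (R-refl : ∀ j {a} → Y a → R j a a) where

    children-disjoint : ∀ {lv} (S : ℕ → Tree h) → Valid lv (node S) →
      ∀ {r r′ a} → Leaf (S r) a → Leaf (S r′) a → r ≡ r′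
    children-disjoint S (valid , separated , _) {r} {r′} a∈ a∈′ with r ≟ r′
    ... | yes r≡r′ = r≡r′
    ... | no  r≢r′ = contradiction (R-refl _ (valid-∈ (S r) (valid r) a∈)) (separated r≢r′ a∈ a∈′)

    leftmost-injective : ∀ {lv} (S : ℕ → Tree h) → Valid lv (node S) → Injective _≡_ _≡_ (leftmost ∘ S)
    leftmost-injective S valid {r} {r′} eq =
      children-disjoint S valid (leftmost-leaf (S r)) (subst (Leaf (S r′)) (sym eq) (leftmost-leaf (S r′)))

    leafAt-injective : ∀ {lv} (T : Tree (suc c)) → Valid lv T → ∀ v → Injective _≡_ _≡_ (leafAt T v)
    leafAt-injective {zero}  (node S) valid []      = leftmost-injective S valid
    leafAt-injective {suc c} (node S) valid (r ∷ v) = leafAt-injective (S r) (proj₁ valid r) v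

module PieceLevels (q : Cond) (k : ℕ) where

  -- E q k re-indexed by ℕ: every level ≥ n q k relates everything.
  E′ : ℕ → Rel
  E′ l a b = ∀ (j : Fin (n q k)) → toℕ j ≡ l → E q k j a b

  E⇒E′ : ∀ {j l a b} → toℕ j ≡ l → E q k j a b → E′ l a b
  E⇒E′ j≡l e j′ j′≡l = subst (λ i → E q k i _ _) (toℕ-injective (trans j≡l (sym j′≡l))) e

  E′⇒E : ∀ {j l a b} → toℕ j ≡ l → E′ l a b → E q k j a b
  E′⇒E j≡l e = e _ j≡l

  E′-refl : ∀ l {a} → X q k a → E′ l a a
  E′-refl l a∈ j _ = proj₁ (equiv q k j) a∈

  E′-sym : ∀ {l a b} → X q k a → X q k b → E′ l a b → E′ l b a
  E′-sym a∈ b∈ e j j≡l = proj₁ (proj₂ (equiv q k j)) a∈ b∈ (e j j≡l)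

  E′-trans : ∀ {l a b c} → X q k a → X q k b → X q k c → E′ l a b → E′ l b c → E′ l a c
  E′-trans a∈ b∈ c∈ e e′ j j≡l = proj₂ (proj₂ (equiv q k j)) a∈ b∈ c∈ (e j j≡l) (e′ j j≡l)

  E′-suc : ∀ {l a b} → X q k a → X q k b → E′ l a b → E′ (suc l) a b
  E′-suc {l} a∈ b∈ e j′ j′≡1+l = proj₁ (chain q k j j′ j′≡1+j) a∈ b∈ (e j (toℕ-fromℕ< l<n))
    where
    l<n : l < n q k
    l<n = <-trans (n<1+n l) (subst (_< n q k) j′≡1+l (toℕ<n j′))
    j : Fin (n q k)
    j = fromℕ< l<n
    j′≡1+j : toℕ j′ ≡ suc (toℕ j)
    j′≡1+j = trans j′≡1+l (cong suc (sym (toℕ-fromℕ< l<n)))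

  E′-mono : ∀ {l l′} → l ≤ l′ → ∀ {a b} → X q k a → X q k b → E′ l a b → E′ l′ a b
  E′-mono {l′ = zero}   z≤n  _  _  e = e
  E′-mono {l′ = suc l′} l≤l′ a∈ b∈ e with m≤n⇒m<n∨m≡n l≤l′
  ... | inj₁ (s≤s l≤l″) = E′-suc a∈ b∈ (E′-mono l≤l″ a∈ b∈ e)
  ... | inj₂ refl       = e

module _ (lem : LEM) {Y : Subset} {E F : Rel} (E-equiv : IsEquivOn Y E) (E<F : E <∞ F on Y)
         {a : ℕ} (a∈Y : Y a) where
  open Classical lem

  private
    E-sym : ∀ {b c} → Y b → Y c → E b c → E c b
    E-sym = proj₁ (proj₂ E-equiv)

    E-trans : ∀ {b c d} → Y b → Y c → Y d → E b c → E c d → E b d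
    E-trans = proj₂ (proj₂ E-equiv)

    fresh : ∀ {s} (b : Fin s → ℕ) → (∀ i → Y (b i)) → ∃[ x ] Y x × F a x × ∀ i → ¬ E x (b i)
    fresh {s} b b∈Y with proj₂ E<F a∈Y (suc s)
    ... | y , y∈Y , Fay , y-separated with lem (∃[ m ] ∀ i → ¬ E (y m) (b i))
    ... | inj₁ (m , new) = y m , y∈Y m , Fay m , new
    ... | inj₂ ¬new      =
      let m₁ , m₂ , m₁<m₂ , same-i = pigeonhole (n<1+n s) (proj₁ ∘ old)
          i , y₁Ebᵢ = old m₁
          y₂Ebᵢ = subst (λ i → E (y m₂) (b i)) (sym same-i) (proj₂ (old m₂))
      in ⊥-elim (y-separated m₁ m₂ (<⇒≢ m₁<m₂ ∘ cong toℕ)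
                   (E-trans (y∈Y m₁) (b∈Y i) (y∈Y m₂) y₁Ebᵢ (E-sym (y∈Y m₂) (b∈Y i) y₂Ebᵢ)))
      where
      old : ∀ m → ∃[ i ] E (y m) (b i)
      old m = byContradiction λ ¬old → ¬new (m , λ i e → ¬old (i , e))

    earlier : ∀ s → Fin s → Σ ℕ Y
    step    : ∀ s → ∃[ x ] Y x × F a x × ∀ i → ¬ E x (proj₁ (earlier s i))
    step s = fresh (proj₁ ∘ earlier s) (proj₂ ∘ earlier s)
    earlier (suc s) Fin.zero    = proj₁ (step s) , proj₁ (proj₂ (step s))
    earlier (suc s) (Fin.suc i) = earlier s i

    earlier-contains : ∀ {s t} → t < s → ∃[ i ] proj₁ (earlier s i) ≡ proj₁ (step t)
    earlier-contains {suc s} (s≤s t≤s) with m≤n⇒m<n∨m≡n t≤s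
    ... | inj₂ refl = Fin.zero , refl
    ... | inj₁ t<s  = let i , eq = earlier-contains t<s in Fin.suc i , eq

  inequivalent-sequence : Σ (ℕ → ℕ) λ x →
    (∀ s → Y (x s)) × (∀ s → F a (x s)) × (∀ s t → s ≢ t → ¬ E (x s) (x t))
  inequivalent-sequence = x , x∈Y , (λ s → proj₁ (proj₂ (proj₂ (step s)))) , separated
    where
    x : ℕ → ℕ
    x = proj₁ ∘ step
    x∈Y : ∀ s → Y (x s)
    x∈Y s = proj₁ (proj₂ (step s))
    separated-below : ∀ {s t} → t < s → ¬ E (x s) (x t)
    separated-below t<s with earlier-contains t<s
    ... | i , eq = subst (λ y → ¬ E (x _) y) eq (proj₂ (proj₂ (proj₂ (step _))) i)
    separated : ∀ s t → s ≢ t → ¬ E (x s) (x t)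
    separated s t s≢t with <-cmp s t
    ... | tri< s<t _ _ = separated-below s<t ∘ E-sym (x∈Y s) (x∈Y t)
    ... | tri≈ _ s≡t _ = contradiction s≡t s≢t
    ... | tri> _ _ t<s = separated-below t<s

module ClassTree (lem : LEM) (q : Cond) (k : ℕ) where
  open PieceLevels q k
  open Levelled (X q k) E′

  spread : ∀ j → suc j < n q k → ∀ {a} → X q k a → Σ (ℕ → ℕ) λ x →
    (∀ s → X q k (x s)) × (∀ s → E′ (suc j) a (x s)) × (∀ s t → s ≢ t → ¬ E′ j (x s) (x t))
  spread j 1+j<n a∈ =
    let x , x∈ , related , separated =
          inequivalent-sequence lem (equiv q k jᶠ) (chain q k jᶠ 1+jᶠ 1+jᶠ≡) a∈
    in x , x∈ , E⇒E′ (toℕ-fromℕ< 1+j<n) ∘ related ,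
       λ s t s≢t → separated s t s≢t ∘ E′⇒E (toℕ-fromℕ< j<n)
    where
    j<n : j < n q k
    j<n = <-trans (n<1+n j) 1+j<n
    jᶠ 1+jᶠ : Fin (n q k)
    jᶠ = fromℕ< j<n
    1+jᶠ = fromℕ< 1+j<n
    1+jᶠ≡ : toℕ 1+jᶠ ≡ suc (toℕ jᶠ)
    1+jᶠ≡ = trans (toℕ-fromℕ< 1+j<n) (cong suc (sym (toℕ-fromℕ< j<n)))

  classTree : ∀ j → j < n q k → ∀ {a} → X q k a → Tree j
  classTree zero    _     {a} _  = leaf a
  classTree (suc j) 1+j<n     a∈ =
    node λ s → classTree j (<-trans (n<1+n j) 1+j<n) (proj₁ (proj₂ (spread j 1+j<n a∈)) s)

  classTree-leaf : ∀ j (j<n : j < n q k) {a} (a∈ : X q k a) →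
    ∀ {b} → Leaf (classTree j j<n a∈) b → X q k b × E′ j a b
  classTree-leaf zero    _     a∈ refl     = a∈ , E′-refl 0 a∈
  classTree-leaf (suc j) 1+j<n {a} a∈ (s , b∈) =
    let b∈X , xEb = classTree-leaf j _ (x∈ s) b∈
    in b∈X , E′-trans a∈ (x∈ s) b∈X (related s) (E′-suc (x∈ s) b∈X xEb)
    where
    x : ℕ → ℕ
    x = proj₁ (spread j 1+j<n a∈)
    x∈ : ∀ s → X q k (x s)
    x∈ = proj₁ (proj₂ (spread j 1+j<n a∈))
    related : ∀ s → E′ (suc j) a (x s)
    related = proj₁ (proj₂ (proj₂ (spread j 1+j<n a∈)))

  classTree-valid : ∀ j (j<n : j < n q k) {a} (a∈ : X q k a) → Valid id (classTree j j<n a∈)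
  classTree-valid zero    _     a∈ = a∈
  classTree-valid (suc j) 1+j<n a∈ =
    (λ s → classTree-valid j _ (x∈ s)) ,
    (λ {r} {r′} r≢r′ b∈ b′∈ bEb′ →
      let b∈X  , xEb  = classTree-leaf j _ (x∈ r) b∈
          b′∈X , x′Eb′ = classTree-leaf j _ (x∈ r′) b′∈
          bEx′ = E′-trans b∈X b′∈X (x∈ r′) bEb′ (E′-sym (x∈ r′) b′∈X x′Eb′)
      in separated r r′ r≢r′ (E′-trans (x∈ r) b∈X (x∈ r′) xEb bEx′)) ,
    (λ b∈ b′∈ →
      let b∈X  , aEb  = classTree-leaf (suc j) 1+j<n a∈ b∈
          b′∈X , aEb′ = classTree-leaf (suc j) 1+j<n a∈ b′∈
      in E′-trans b∈X a∈ b′∈X (E′-sym a∈ b∈X aEb) aEb′)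
    where
    x : ℕ → ℕ
    x = proj₁ (spread j 1+j<n a∈)
    x∈ : ∀ s → X q k (x s)
    x∈ = proj₁ (proj₂ (spread j 1+j<n a∈))
    separated : ∀ s t → s ≢ t → ¬ E′ j (x s) (x t)
    separated = proj₂ (proj₂ (proj₂ (spread j 1+j<n a∈)))

module Disjointify (lem : LEM) (f : ℕ → ℕ) (Y : ℕ → Subset) (R : ℕ → ℕ → Rel)
  (R-refl : ∀ r j {a} → Y r a → R r j a a) {c : ℕ → ℕ} (lv : ℕ → ℕ → ℕ) (J : ∀ r → Tree (suc (c r)))
  (J-valid : ∀ r → Levelled.Valid (Y r) (R r) (lv r) (J r)) (J-injective : ∀ r → InjectiveOn f (Leaf (J r)))
  where
  open Classical lem

  BottomChild : Set
  BottomChild = (Σ ℕ λ r → Vec ℕ (c r)) × ℕ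

  value : BottomChild → ℕ → ℕ
  value ((r , v) , _) i = f (leafAt (J r) v i)

  value-injective : ∀ x → Injective _≡_ _≡_ (value x)
  value-injective ((r , v) , _) eq =
    Levelled.leafAt-injective (Y r) (R r) (R-refl r) (J r) (J-valid r) v
      (J-injective r (leafAt-leaf (J r) v _) (leafAt-leaf (J r) v _) eq)

  private
    choice : Σ (BottomChild → ℕ) λ t → Injective _≡_ _≡_ (λ x → value x (t x))
    choice = separating-choice
      (enumerable-× (enumerable-Σℕ λ r → enumerable-Vec ℕ-enumerable (c r)) ℕ-enumerable)
      value value-injective

  chosen : BottomChild → ℕ
  chosen = proj₁ choice

  chosen-separating : Injective _≡_ _≡_ (λ x → value x (chosen x))
  chosen-separating = proj₂ choice

  J′ : ∀ r → Tree (suc (c r))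
  J′ r = thin (J r) λ v s → chosen ((r , v) , s)

  J′-valid : ∀ r → Levelled.Valid (Y r) (R r) (lv r) (J′ r)
  J′-valid r = Levelled.thin-valid (Y r) (R r) (J r) _
    (λ v {s} {s′} eq →
      cong proj₂ (chosen-separating {(r , v) , s} {(r , v) , s′} (cong (value ((r , v) , s)) eq)))
    (J-valid r)

  J′-⊆ : ∀ r {a} → Leaf (J′ r) a → Leaf (J r) a
  J′-⊆ r = thin-⊆ (J r) _

  J′-injective : InjectiveOn f (λ a → ∃[ r ] Leaf (J′ r) a)
  J′-injective (r , a∈) (r′ , b∈) eq with thin-leaf (J r) _ a∈ | thin-leaf (J r′) _ b∈
  ... | v , s , refl | v′ , s′ , refl =
    cong (λ ((r , v) , s) → leafAt (J r) v (chosen ((r , v) , s)))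
      (chosen-separating {(r , v) , s} {(r′ , v′) , s′} eq)

constantOn-singleton : ∀ f x → ConstantOn f (x ≡_)
constantOn-singleton f x refl refl = refl

injectiveOn-singleton : ∀ f x → InjectiveOn f (x ≡_)
injectiveOn-singleton f x refl refl _ = refl

module Ramsey (lem : LEM) (f : ℕ → ℕ) (Y : Subset) (R : ℕ → Rel)
  (R-refl : ∀ j {a} → Y a → R j a a)
  (R-mono : ∀ {j j′} → j ≤ j′ → ∀ {a b} → Y a → Y b → R j a b → R j′ a b) where
  open Classical lem
  open Levelled Y R

  record Subtree (T : Tree h) (top c : ℕ) (Q : Subset → Set) : Set where
    field
      tree        : Tree c
      level       : ℕ → ℕ
      valid       : Valid level tree
      level-zero  : level 0 ≡ 0
      ascending   : AscendingBelow c level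
      level-bound : level c ≤ top
      ⊆T          : ∀ {a} → Leaf tree a → Leaf T a
      property    : Q (Leaf tree)

    level-≤-top : ∀ j → j ≤ c → level j ≤ top
    level-≤-top j j≤c = ≤-trans (ascendingBelow-≤ ascending j≤c ≤-refl) level-bound

  open Subtree

  ConstantOrInjective : Tree h → ℕ → ℕ → ℕ → Set
  ConstantOrInjective T top a b = Subtree T top a (ConstantOn f) ⊎ Subtree T top b (InjectiveOn f)

  singleton : ∀ {lv} Q → (∀ x → Q (x ≡_)) → (T : Tree h) → Valid lv T → ∀ {x} → Leaf T x → ∀ top →
    Subtree T top 0 Q
  singleton Q Q-singleton T T-valid x∈ top = record
    { tree        = leaf _
    ; level       = λ _ → 0
    ; valid       = valid-∈ T T-valid x∈
    ; level-zero  = refl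
    ; ascending   = λ _ ()
    ; level-bound = z≤n
    ; ⊆T          = λ { refl → x∈ }
    ; property    = Q-singleton _
    }

  lift : ∀ {S : ℕ → Tree h} {r top top′ c Q} → Subtree (S r) top c Q → top ≤ top′ → Subtree (node S) top′ c Q
  lift {r = r} sub top≤top′ = record
    { tree        = tree sub
    ; level       = level sub
    ; valid       = valid sub
    ; level-zero  = level-zero sub
    ; ascending   = ascending sub
    ; level-bound = ≤-trans (level-bound sub) top≤top′
    ; ⊆T          = λ a∈ → r , ⊆T sub a∈
    ; property    = property sub
    }

  agreeing : ∀ {U : ℕ → Tree h} {top c Q} (sub : ∀ r → Subtree (U r) top c Q) →
    Σ (ℕ → ℕ) λ τ → Ascending τ × ∀ s j → j < suc c → level (sub (τ s)) j ≡ level (sub (τ 0)) j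
  agreeing sub = agreeing-subsequence (suc _) _ (level ∘ sub) λ r j j<1+c → level-≤-top (sub r) j (≤-pred j<1+c)

  graft : ∀ {S : ℕ → Tree h} {lv c Q} → Valid lv (node S) → AscendingBelow (suc h) lv →
    ∀ {σ} → Injective _≡_ _≡_ σ → (sub : ∀ s → Subtree (S (σ s)) (lv h) c Q) →
    (∀ s j → j < suc c → level (sub s) j ≡ level (sub 0) j) →
    Q (Leaf (node (tree ∘ sub))) → Subtree (node S) (lv (suc h)) (suc c) Q
  graft {h} {S} {lv} {c} (_ , separated , related) lv↑ {σ} σ-injective sub agree Q-node = record
    { tree        = node (tree ∘ sub)
    ; level       = level′
    ; valid       =
        (λ s → valid-cong (tree (sub s)) (λ j j<1+c → trans (agree s j j<1+c) (sym (level′-≤ (≤-pred j<1+c))))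
                 (valid (sub s))) ,
        (λ {r} {r′} r≢r′ a∈ b∈ → separated (r≢r′ ∘ σ-injective) (⊆T (sub r) a∈) (⊆T (sub r′) b∈)
                                   ∘ R-mono level′-c≤lv-h (∈Y a∈) (∈Y b∈)) ,
        (λ a∈ b∈ → subst (λ l → R l _ _) (sym level′-top) (related (⊆node a∈) (⊆node b∈)))
    ; level-zero  = trans (level′-≤ z≤n) (level-zero (sub 0))
    ; ascending   = ascending′
    ; level-bound = ≤-reflexive (level′-top)
    ; ⊆T          = ⊆node
    ; property    = Q-node
    }
    where
    L₀ level′ : ℕ → ℕ
    L₀ = level (sub 0)
    level′ = extend L₀ c (lv (suc h))

    level′-≤ : ∀ {j} → j ≤ c → level′ j ≡ L₀ j
    level′-≤ = extend-≤ L₀ (lv (suc h))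

    level′-top : level′ (suc c) ≡ lv (suc h)
    level′-top = extend-suc L₀ c (lv (suc h))

    ⊆node : ∀ {a} → Leaf (node (tree ∘ sub)) a → Leaf (node S) a
    ⊆node (s , a∈) = σ s , ⊆T (sub s) a∈

    ∈Y : ∀ {s a} → Leaf (tree (sub s)) a → Y a
    ∈Y {s} = valid-∈ (tree (sub s)) (valid (sub s))

    level′-c≤lv-h : level′ c ≤ lv h
    level′-c≤lv-h = ≤-trans (≤-reflexive (level′-≤ ≤-refl)) (level-bound (sub 0))

    ascending′ : AscendingBelow (suc c) level′
    ascending′ j (s≤s j≤c) with m≤n⇒m<n∨m≡n j≤c
    ... | inj₁ j<c  = subst₂ _<_ (sym (level′-≤ j≤c)) (sym (level′-≤ j<c)) (ascending (sub 0) j j<c)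
    ... | inj₂ refl = subst₂ _<_ (sym (level′-≤ ≤-refl)) (sym level′-top)
                        (≤-<-trans (level-bound (sub 0)) (lv↑ h ≤-refl))

  constant-children : ∀ {S : ℕ → Tree h} {lv c} → Valid lv (node S) → AscendingBelow (suc h) lv →
    (∀ r → Subtree (S r) (lv h) c (ConstantOn f)) → ConstantOrInjective (node S) (lv (suc h)) (suc c) 1
  constant-children {h} {S} {lv} {c} S-valid lv↑ sub with infinite-fibre-or-ascending (f ∘ leftmost ∘ tree ∘ sub)
  ... | inj₁ (x , fibre) =
    inj₁ (graft S-valid lv↑ (ascending-injective (ascending-∘ σ↑ τ↑)) (sub ∘ σ ∘ τ) agree constant)
    where
    σ τ : ℕ → ℕ
    σ = enumerate fibre
    σ↑ : Ascending σ
    σ↑ = enumerate-ascending fibre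
    τ = proj₁ (agreeing (sub ∘ σ))
    τ↑ : Ascending τ
    τ↑ = proj₁ (proj₂ (agreeing (sub ∘ σ)))
    agree : ∀ s j → j < suc c → level (sub (σ (τ s))) j ≡ level (sub (σ (τ 0))) j
    agree = proj₂ (proj₂ (agreeing (sub ∘ σ)))
    value-at : ∀ s {a} → Leaf (tree (sub (σ (τ s)))) a → f a ≡ x
    value-at s a∈ = trans (property (sub (σ (τ s))) a∈ (leftmost-leaf _)) (enumerate-∈ fibre (τ s))
    constant : ConstantOn f (Leaf (node (tree ∘ sub ∘ σ ∘ τ)))
    constant (s , a∈) (s′ , b∈) = trans (value-at s a∈) (sym (value-at s′ b∈))
  ... | inj₂ (σ , σ↑ , value↑) =
    inj₂ (graft S-valid lv↑ (ascending-injective σ↑) point (λ _ _ _ → refl) injective)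
    where
    point : ∀ s → Subtree (S (σ s)) (lv h) 0 (InjectiveOn f)
    point s = singleton (InjectiveOn f) (injectiveOn-singleton f)
                (S (σ s)) (proj₁ S-valid (σ s)) (⊆T (sub (σ s)) (leftmost-leaf _)) _
    injective : InjectiveOn f (Leaf (node (tree ∘ point)))
    injective (s , refl) (s′ , refl) eq = cong (leftmost ∘ tree ∘ sub ∘ σ) (ascending-injective value↑ eq)

  injective-children : ∀ {S : ℕ → Tree h} {lv c} → Valid lv (node S) → AscendingBelow (suc h) lv →
    (∀ r → Subtree (S r) (lv h) (suc c) (InjectiveOn f)) →
    Subtree (node S) (lv (suc h)) (suc (suc c)) (InjectiveOn f)
  injective-children {h} {S} {lv} {c} S-valid lv↑ sub =
    graft S-valid lv↑ (ascending-injective τ↑) thinned (λ _ _ _ → refl) D.J′-injective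
    where
    τ : ℕ → ℕ
    τ = proj₁ (agreeing sub)
    τ↑ : Ascending τ
    τ↑ = proj₁ (proj₂ (agreeing sub))
    agree : ∀ s j → j < suc (suc c) → level (sub (τ s)) j ≡ level (sub (τ 0)) j
    agree = proj₂ (proj₂ (agreeing sub))
    L₀ : ℕ → ℕ
    L₀ = level (sub (τ 0))
    module D = Disjointify lem f (λ _ → Y) (λ _ → R) (λ _ → R-refl) (λ _ → L₀) (tree ∘ sub ∘ τ)
                 (λ s → valid-cong (tree (sub (τ s))) (agree s) (valid (sub (τ s)))) (property ∘ sub ∘ τ)
    thinned : ∀ s → Subtree (S (τ s)) (lv h) (suc c) (InjectiveOn f)
    thinned s = record
      { tree        = D.J′ s
      ; level       = L₀
      ; valid       = D.J′-valid s
      ; level-zero  = level-zero (sub (τ 0))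
      ; ascending   = ascending (sub (τ 0))
      ; level-bound = level-bound (sub (τ 0))
      ; ⊆T          = ⊆T (sub (τ s)) ∘ D.J′-⊆ s
      ; property    = λ a∈ b∈ → D.J′-injective (s , a∈) (s , b∈)
      }

  ramsey : ∀ {h lv} (T : Tree h) → Valid lv T → AscendingBelow h lv →
    ∀ a b → a + b ≡ suc h → ConstantOrInjective T (lv h) a b
  ramsey T T-valid _ zero    b    _ =
    inj₁ (singleton (ConstantOn f) (constantOn-singleton f) T T-valid (leftmost-leaf T) _)
  ramsey T T-valid _ (suc a) zero _ =
    inj₂ (singleton (InjectiveOn f) (injectiveOn-singleton f) T T-valid (leftmost-leaf T) _)
  ramsey (leaf x) _ _ (suc a) (suc b) eq = contradiction (trans (sym (+-suc a b)) (suc-injective eq)) λ ()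
  ramsey {lv = lv} (node {h} S) S-valid lv↑ (suc a) (suc b) eq
    with lem (∃[ r ] Subtree (S r) (lv h) (suc b) (InjectiveOn f))
       | lem (∃[ r ] Subtree (S r) (lv h) (suc a) (ConstantOn f))
  ... | inj₁ (r , sub)  | _              = inj₂ (lift sub (<⇒≤ (lv↑ h ≤-refl)))
  ... | inj₂ _          | inj₁ (r , sub) = inj₁ (lift sub (<⇒≤ (lv↑ h ≤-refl)))
  ... | inj₂ ¬injective | inj₂ ¬constant = children b constant injective
    where
    lv↑′ : AscendingBelow h lv
    lv↑′ j j<h = lv↑ j (m<n⇒m<1+n j<h)
    a+1+b≡1+h : a + suc b ≡ suc h
    a+1+b≡1+h = suc-injective eq
    constant : ∀ r → Subtree (S r) (lv h) a (ConstantOn f)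
    constant r with ramsey (S r) (proj₁ S-valid r) lv↑′ a (suc b) a+1+b≡1+h
    ... | inj₁ sub = sub
    ... | inj₂ sub = contradiction (r , sub) ¬injective
    injective : ∀ r → Subtree (S r) (lv h) b (InjectiveOn f)
    injective r with ramsey (S r) (proj₁ S-valid r) lv↑′ (suc a) b (trans (sym (+-suc a b)) a+1+b≡1+h)
    ... | inj₁ sub = contradiction (r , sub) ¬constant
    ... | inj₂ sub = sub
    children : ∀ b → (∀ r → Subtree (S r) (lv h) a (ConstantOn f)) →
      (∀ r → Subtree (S r) (lv h) b (InjectiveOn f)) → ConstantOrInjective (node S) (lv (suc h)) (suc a) (suc b)
    children zero    constant _         = constant-children S-valid lv↑ constant
    children (suc b) _        injective = inj₂ (injective-children S-valid lv↑ injective)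

isEquivOn-⊆ : ∀ {U V : Subset} {R : Rel} → (∀ {a} → U a → V a) → IsEquivOn V R → IsEquivOn U R
isEquivOn-⊆ U⊆V (refl′ , sym′ , trans′) =
  (refl′ ∘ U⊆V) ,
  (λ a∈ b∈ → sym′ (U⊆V a∈) (U⊆V b∈)) ,
  (λ a∈ b∈ c∈ → trans′ (U⊆V a∈) (U⊆V b∈) (U⊆V c∈))

valid-infinite : LEM → ∀ {Y R lv} → (∀ j {a} → Y a → R j a a) →
  (T : Tree (suc h)) → Levelled.Valid Y R lv T → Infinite (Leaf T)
valid-infinite lem {Y} {R} R-refl (node S) S-valid k =
  let r , k<x = Classical.injective⇒unbounded lem (Levelled.leftmost-injective Y R R-refl S S-valid) k
  in leftmost (S r) , <⇒≤ k<x , r , leftmost-leaf (S r)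

record PieceTree (q : Cond) : Set where
  field
    piece       : ℕ
    height      : ℕ
    tree        : Tree (suc height)
    level       : ℕ → ℕ
    valid       : Levelled.Valid (X q piece) (PieceLevels.E′ q piece) level tree
    level-zero  : level 0 ≡ 0
    ascending   : AscendingBelow (suc height) level
    level-bound : level (suc height) < n q piece

module Refinement (lem : LEM) (q : Cond) (P : ℕ → PieceTree q)
  (pieces-distinct : Injective _≡_ _≡_ (PieceTree.piece ∘ P)) (tall : ∀ i → i ≤ PieceTree.height (P i)) where

  module Piece (i : ℕ) where
    open PieceTree (P i) public
    open PieceLevels q piece
    open Levelled (X q piece) E′

    levels : ℕ
    levels = suc (suc height)

    level< : (j : Fin levels) → level (toℕ j) < n q piece
    level< j = ≤-<-trans (ascendingBelow-≤ ascending (≤-pred (toℕ<n j)) ≤-refl) level-bound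

    π : Fin levels → Fin (n q piece)
    π j = fromℕ< (level< j)

    π≡ : ∀ j → toℕ (π j) ≡ level (toℕ j)
    π≡ j = toℕ-fromℕ< (level< j)

    π-increasing : StrictlyIncreasing π
    π-increasing j j′ j<j′ =
      subst₂ _<_ (sym (π≡ j)) (sym (π≡ j′)) (ascendingBelow-< ascending j<j′ (≤-pred (toℕ<n j′)))

    Eᵢ : Fin levels → Rel
    Eᵢ j = E q piece (π j)

    ∈X : ∀ {a} → Leaf tree a → X q piece a
    ∈X = valid-∈ tree valid

    Eᵢ-chain : ∀ j j′ → toℕ j′ ≡ suc (toℕ j) → Eᵢ j <∞ Eᵢ j′ on Leaf tree
    Eᵢ-chain j j′ j′≡1+j = coarser , λ a∈ K →
      let x , x∈ , related , separated = valid-spread tree valid a∈ (toℕ j) j<1+height K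
      in x , x∈ , E′⇒E (trans (π≡ j′) (cong level j′≡1+j)) ∘ related ,
         λ m m′ m≢m′ → separated m m′ m≢m′ ∘ E⇒E′ (π≡ j)
      where
      j<1+height : toℕ j < suc height
      j<1+height = ≤-pred (subst (_< levels) j′≡1+j (toℕ<n j′))
      coarser : ∀ {a b} → Leaf tree a → Leaf tree b → Eᵢ j a b → Eᵢ j′ a b
      coarser a∈ b∈ = E′⇒E (π≡ j′) ∘ E′-mono level-j≤level-j′ (∈X a∈) (∈X b∈) ∘ E⇒E′ (π≡ j)
        where
        level-j≤level-j′ =
          ascendingBelow-≤ ascending (≤-trans (n≤1+n _) (≤-reflexive (sym j′≡1+j))) (≤-pred (toℕ<n j′))

  open Piece

  cond : Cond
  cond = record
    { X        = λ i → Leaf (tree i)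
    ; n        = λ i → suc (suc (height i))
    ; E        = Eᵢ
    ; disjoint = λ i≢i′ a∈ a∈′ → disjoint q (i≢i′ ∘ pieces-distinct) (∈X _ a∈) (∈X _ a∈′)
    ; infinite = λ i → valid-infinite lem (PieceLevels.E′-refl q (piece i)) (tree i) (valid i)
    ; nonempty = λ _ → s≤s z≤n
    ; equiv    = λ i j → isEquivOn-⊆ (∈X i) (equiv q (piece i) (π i j))
    ; chain    = Eᵢ-chain
    ; bottom   = λ i j j≡0 a∈ b∈ →
        bottom q (piece i) (π i j) (trans (π≡ i j) (trans (cong (level i) j≡0) (level-zero i)))
          (∈X i a∈) (∈X i b∈)
    ; top      = λ i j j≡top a∈ b∈ →
        PieceLevels.E′⇒E q (piece i) (trans (π≡ i j) (cong (level i) j≡top))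
          (Levelled.valid-top _ _ (tree i) (valid i) a∈ b∈)
    ; limsup   = λ N k → N + k , m≤n+m k N ,
        ≤-trans (m≤m+n N k) (≤-trans (tall (N + k)) (≤-trans (n≤1+n _) (n≤1+n _)))
    }

  cond≤q : cond ≤ℙ q
  cond≤q = 0 , λ i _ → piece i , ∈X i , π i , π-increasing i , λ j _ _ → mk⇔ id id

HomogeneousRefinement : (ℕ → ℕ) → Cond → Set₁
HomogeneousRefinement f q = Σ Cond λ p → p ≤ℙ q ×
  (ConstantOn f (Union p) ⊎ InjectiveOn f (Union p) ⊎ PiecewiseConstantDistinct f p)

module _ (lem : LEM) (f : ℕ → ℕ) (q : Cond) where
  open Classical lem
  open PieceLevels using (E′; E′-refl; E′-mono)

  -- (i + 1) + (i + 1) = height i + 1, as ramsey needs for a = b = i + 1.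
  height : ℕ → ℕ
  height i = suc i + i

  long-piece-after : ∀ i k → ∃[ k′ ] k ≤ k′ × suc (height i) ≤ n q k′
  long-piece-after i = limsup q (suc (height i))

  piece : ℕ → ℕ
  piece zero    = proj₁ (long-piece-after 0 0)
  piece (suc i) = proj₁ (long-piece-after (suc i) (suc (piece i)))

  piece-ascending : Ascending piece
  piece-ascending i = proj₁ (proj₂ (long-piece-after (suc i) (suc (piece i))))

  piece-long : ∀ i → height i < n q (piece i)
  piece-long zero    = proj₂ (proj₂ (long-piece-after 0 0))
  piece-long (suc i) = proj₂ (proj₂ (long-piece-after (suc i) (suc (piece i))))

  root : ∀ i → Σ ℕ (X q (piece i))
  root i = let a , _ , a∈ = infinite q (piece i) 0 in a , a∈

  classTree : ∀ i → Tree (height i)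
  classTree i = ClassTree.classTree lem q (piece i) (height i) (piece-long i) (proj₂ (root i))

  module RamseyAt (i : ℕ) =
    Ramsey lem f (X q (piece i)) (E′ q (piece i)) (E′-refl q (piece i)) (E′-mono q (piece i))

  HasSubtree : (Subset → Set) → ℕ → Set
  HasSubtree Q i = RamseyAt.Subtree i (classTree i) (height i) (suc i) Q

  ramsey-at : ∀ i → HasSubtree (ConstantOn f) i ⊎ HasSubtree (InjectiveOn f) i
  ramsey-at i = RamseyAt.ramsey i (classTree i)
    (ClassTree.classTree-valid lem q (piece i) (height i) (piece-long i) (proj₂ (root i)))
    (λ _ _ → ≤-refl) (suc i) (suc i) (cong suc (+-suc i i))

  toPieceTree : ∀ {Q} i → HasSubtree Q i → PieceTree q
  toPieceTree i sub = record
    { piece       = piece i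
    ; height      = i
    ; tree        = tree
    ; level       = level
    ; valid       = valid
    ; level-zero  = level-zero
    ; ascending   = ascending
    ; level-bound = ≤-<-trans level-bound (piece-long i)
    }
    where open RamseyAt.Subtree i sub

  subtree : ∀ {Q} i → HasSubtree Q i → Tree (suc i)
  subtree i = RamseyAt.Subtree.tree {i = i}

  subtree-property : ∀ {Q} i (sub : HasSubtree Q i) → Q (Leaf (subtree i sub))
  subtree-property i = RamseyAt.Subtree.property {i = i}

  module Along {ρ} (ρ↑ : Ascending ρ) {Q} (sub : ∀ s → HasSubtree Q (ρ s)) =
    Refinement lem q (λ s → toPieceTree (ρ s) (sub s))
      (ascending-injective ρ↑ ∘ ascending-injective piece-ascending) (ascending-inflationary ρ↑)

  constant-outcome : ∀ {σ} → Ascending σ → (∀ s → HasSubtree (ConstantOn f) (σ s)) → HomogeneousRefinement f q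
  constant-outcome {σ} σ↑ sub with infinite-fibre-or-ascending (λ s → f (leftmost (subtree (σ s) (sub s))))
  ... | inj₁ (x , fibre) =
    R.cond , R.cond≤q , inj₁ λ (s , a∈) (s′ , b∈) → trans (value-at s a∈) (sym (value-at s′ b∈))
    where
    τ : ℕ → ℕ
    τ = enumerate fibre
    module R = Along (ascending-∘ σ↑ (enumerate-ascending fibre)) (sub ∘ τ)
    value-at : ∀ s {a} → Leaf (subtree (σ (τ s)) (sub (τ s))) a → f a ≡ x
    value-at s a∈ = trans (subtree-property (σ (τ s)) (sub (τ s)) a∈ (leftmost-leaf _)) (enumerate-∈ fibre s)
  ... | inj₂ (τ , τ↑ , value↑) = R.cond , R.cond≤q , inj₂ (inj₂ (constant , distinct))
    where
    module R = Along (ascending-∘ σ↑ τ↑) (sub ∘ τ)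
    constant : ∀ s → ConstantOn f (Leaf (subtree (σ (τ s)) (sub (τ s))))
    constant s = subtree-property (σ (τ s)) (sub (τ s))
    distinct : ∀ {s s′ a b} → s ≢ s′ → Leaf (subtree (σ (τ s)) (sub (τ s))) a →
      Leaf (subtree (σ (τ s′)) (sub (τ s′))) b → f a ≢ f b
    distinct s≢s′ a∈ b∈ eq = s≢s′ (ascending-injective value↑
      (trans (sym (constant _ a∈ (leftmost-leaf _))) (trans eq (constant _ b∈ (leftmost-leaf _)))))

  injective-outcome : Infinite (HasSubtree (InjectiveOn f)) → HomogeneousRefinement f q
  injective-outcome infinitely-often = R.cond , R.cond≤q , inj₂ (inj₁ D.J′-injective)
    where
    σ : ℕ → ℕ
    σ = enumerate infinitely-often
    σ↑ : Ascending σ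
    σ↑ = enumerate-ascending infinitely-often
    module S (s : ℕ) = RamseyAt.Subtree (σ s) (enumerate-∈ infinitely-often s)
    module D = Disjointify lem f (X q ∘ piece ∘ σ) (E′ q ∘ piece ∘ σ) (E′-refl q ∘ piece ∘ σ)
                 S.level S.tree S.valid S.property
    thinned : ℕ → PieceTree q
    thinned s = record
      { piece       = piece (σ s)
      ; height      = σ s
      ; tree        = D.J′ s
      ; level       = S.level s
      ; valid       = D.J′-valid s
      ; level-zero  = S.level-zero s
      ; ascending   = S.ascending s
      ; level-bound = ≤-<-trans (S.level-bound s) (piece-long (σ s))
      }
    module R = Refinement lem q thinned (ascending-injective σ↑ ∘ ascending-injective piece-ascending)
                 (ascending-inflationary σ↑)

  eventually-constant-outcome : ∀ K → (∀ i → K ≤ i → ¬ HasSubtree (InjectiveOn f) i) → HomogeneousRefinement f q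
  eventually-constant-outcome K ¬injective =
    constant-outcome {K +_} (λ s → ≤-reflexive (sym (+-suc K s))) λ s →
      [ id , (λ sub → contradiction sub (¬injective (K + s) (m≤m+n K s))) ]′ (ramsey-at (K + s))

lemma3p8 : LEM → (f : ℕ → ℕ) (q : Cond) →
    Σ Cond (λ p → (p ≤ℙ q) ×
      (ConstantOn f (Union p) ⊎ InjectiveOn f (Union p) ⊎ PiecewiseConstantDistinct f p))
lemma3p8 lem f q with lem (Infinite (HasSubtree lem f q (InjectiveOn f)))
... | inj₁ infinitely-often = injective-outcome lem f q infinitely-often
... | inj₂ finitely-often   =
  let K , ¬injective = Classical.finite⇒eventually-¬ lem finitely-often
  in eventually-constant-outcome lem f q K ¬injective
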